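{- Let $p$ be an odd prime. The solutions in non-negative integers $x,y,z$ of the Diophantine equation $$64^{x}+p^{y}=z^{2}$$ are given by $(x,y,z)=(k,1,2^{3k}+1)$ for $p=1+2^{3k+1}$, where $k$ is a non-negative integer. -}

{-# OPTIONS --safe #-}
-- Put w = 2^(3x), so that 64^x = w². Then p^y = (z − w)(z + w), and p cannot divide both
-- factors, since it would divide their difference 2w, a power of 2; hence z − w = 1 and
-- p^y = 1 + 2w. An even y is impossible modulo 7, as 1 + 2w ≡ 3 is not a square mod 7.
-- For odd y, p^y − 1 = (p − 1)(1 + p + ⋯ + p^(y−1)) with an odd second factor that divides
-- a power of 2; this factor is at least y, so it is 1 and y = 1.
module Submission where

open import Data.Nat using (ℕ; zero; suc; _+_; _*_; _^_; _∸_; _≤_; _<_; _%_; z≤n; s≤s; NonZero)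
open import Data.Nat.Base using (nonTrivial⇒≢1)
open import Data.Nat.Properties
open import Data.Nat.DivMod using (m%n<n; %-distribˡ-+; %-distribˡ-*)
open import Data.Nat.Divisibility
open import Data.Nat.Coprimality using (Coprime; coprime-divisor)
open import Data.Nat.Primality using (Prime; prime[2]; prime⇒irreducible; prime⇒nonTrivial)
open import Data.Nat.Tactic.RingSolver using (solve-∀)
open import Data.Product using (∃-syntax; _×_; _,_)
open import Data.Sum using (_⊎_; inj₁; inj₂)
open import Relation.Nullary using (yes; no; contradiction)
open import Relation.Binary.PropositionalEquality
open import Function.Bundles using (_⇔_; mk⇔)

coprime∧∣^⇒≡1 : ∀ {a m} n → Coprime a m → a ∣ m ^ n → a ≡ 1
coprime∧∣^⇒≡1 zero    _   a∣1   = ∣1⇒≡1 a∣1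
coprime∧∣^⇒≡1 (suc n) a⊥m a∣m^n = coprime∧∣^⇒≡1 n a⊥m (coprime-divisor a⊥m a∣m^n)

∤⇒coprime : ∀ {p n} → Prime p → p ∤ n → Coprime n p
∤⇒coprime pp p∤n (d∣n , d∣p) with prime⇒irreducible pp d∣p
... | inj₁ d≡1 = d≡1
... | inj₂ refl = contradiction d∣n p∤n

prime-power-factors : ∀ {p a b} n → Prime p → a * b ≡ p ^ n →
                      a ≡ 1 ⊎ b ≡ 1 ⊎ (p ∣ a × p ∣ b)
prime-power-factors {p} {a} {b} n pp ab≡p^n with p ∣? a | p ∣? b
... | no p∤a | _ =
  inj₁ (coprime∧∣^⇒≡1 n (∤⇒coprime pp p∤a) (subst (a ∣_) ab≡p^n (m∣m*n b)))
... | yes _ | no p∤b =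
  inj₂ (inj₁ (coprime∧∣^⇒≡1 n (∤⇒coprime pp p∤b) (subst (b ∣_) ab≡p^n (n∣m*n a))))
... | yes p∣a | yes p∣b = inj₂ (inj₂ (p∣a , p∣b))

m*m≤n*n⇒m≤n : ∀ {m n} → m * m ≤ n * n → m ≤ n
m*m≤n*n⇒m≤n {m} {n} m²≤n² with m ≤? n
... | yes m≤n = m≤n
... | no m≰n = contradiction m²≤n² (<⇒≱ (*-mono-< n<m n<m))
  where n<m = ≰⇒> m≰n

m*m+n≡o*o⇒difference-of-squares : ∀ {m n o} → m * m + n ≡ o * o →
                                  ∃[ a ] (o ≡ m + a × a * (a + 2 * m) ≡ n)
m*m+n≡o*o⇒difference-of-squares {m} {n} {o} eq = a , o≡m+a , +-cancelˡ-≡ (m * m) _ _ (begin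
  m * m + a * (a + 2 * m)   ≡⟨ expand m a ⟨
  (m + a) * (m + a)         ≡⟨ cong (λ t → t * t) o≡m+a ⟨
  o * o                     ≡⟨ eq ⟨
  m * m + n                 ∎)
  where
  open ≡-Reasoning
  a = o ∸ m
  o≡m+a : o ≡ m + a
  o≡m+a = sym (m+[n∸m]≡n (m*m≤n*n⇒m≤n {m} (subst (m * m ≤_) eq (m≤m+n (m * m) n))))
  expand : ∀ m a → (m + a) * (m + a) ≡ m * m + a * (a + 2 * m)
  expand = solve-∀

2∤n⇒2∣1+n : ∀ n → 2 ∤ n → 2 ∣ suc n
2∤n⇒2∣1+n zero          2∤0 = contradiction (2 ∣0) 2∤0
2∤n⇒2∣1+n (suc zero)    _   = ∣-refl
2∤n⇒2∣1+n (suc (suc n)) 2∤n+2 =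
  ∣m∣n⇒∣m+n ∣-refl (2∤n⇒2∣1+n n (λ 2∣n → 2∤n+2 (∣m∣n⇒∣m+n ∣-refl 2∣n)))

geometricSum : ℕ → ℕ → ℕ
geometricSum b zero    = 0
geometricSum b (suc n) = b ^ n + geometricSum b n

[1+q]^n≡1+q*geometricSum : ∀ q n → suc q ^ n ≡ 1 + q * geometricSum (suc q) n
[1+q]^n≡1+q*geometricSum q zero    = cong suc (sym (*-zeroʳ q))
[1+q]^n≡1+q*geometricSum q (suc n) = begin
  suc q * suc q ^ n             ≡⟨ cong (suc q *_) ih ⟩
  suc q * (1 + q * G)           ≡⟨ expand q G ⟩
  1 + q * ((1 + q * G) + G)     ≡⟨ cong (λ t → 1 + q * (t + G)) (sym ih) ⟩
  1 + q * (suc q ^ n + G)       ∎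
  where
  open ≡-Reasoning
  G = geometricSum (suc q) n
  ih = [1+q]^n≡1+q*geometricSum q n
  expand : ∀ q g → (1 + q) * (1 + q * g) ≡ 1 + q * ((1 + q * g) + g)
  expand = solve-∀

n≤geometricSum : ∀ b .{{_ : NonZero b}} n → n ≤ geometricSum b n
n≤geometricSum b zero    = z≤n
n≤geometricSum b (suc n) = +-mono-≤ (m^n>0 b n) (n≤geometricSum b n)

geometricSum-odd : ∀ {b} n → 2 ∤ b → 2 ∤ n → 2 ∤ geometricSum b n
geometricSum-odd zero                 _   2∤0 = contradiction (2 ∣0) 2∤0
geometricSum-odd (suc zero)           _   _   = λ 2∣1 → contradiction (∣1⇒≡1 2∣1) λ ()
geometricSum-odd {b} (suc (suc n)) 2∤b 2∤n+2 2∣sum =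
  geometricSum-odd n 2∤b 2∤n (∣m+n∣m⇒∣n (subst (2 ∣_) regroup 2∣sum) 2∣[1+b]b^n)
  where
  2∤n : 2 ∤ n
  2∤n 2∣n = 2∤n+2 (∣m∣n⇒∣m+n ∣-refl 2∣n)
  2∣[1+b]b^n : 2 ∣ suc b * b ^ n
  2∣[1+b]b^n = ∣-trans (2∤n⇒2∣1+n b 2∤b) (m∣m*n (b ^ n))
  regroup : b * b ^ n + (b ^ n + geometricSum b n) ≡ suc b * b ^ n + geometricSum b n
  regroup = trans (sym (+-assoc (b * b ^ n) (b ^ n) (geometricSum b n)))
                  (cong (_+ geometricSum b n) (+-comm (b * b ^ n) (b ^ n)))

[1+q]^n≡1+2^m⇒n≡1 : ∀ q m n → 2 ∤ suc q → 2 ∤ n → suc q ^ n ≡ 1 + 2 ^ m → n ≡ 1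
[1+q]^n≡1+2^m⇒n≡1 q m n 2∤1+q 2∤n eq =
  odd∧≤1⇒≡1 n 2∤n (subst (n ≤_) G≡1 (n≤geometricSum (suc q) n))
  where
  G = geometricSum (suc q) n
  qG≡2^m : q * G ≡ 2 ^ m
  qG≡2^m = +-cancelˡ-≡ 1 _ _ (trans (sym ([1+q]^n≡1+q*geometricSum q n)) eq)
  G≡1 : G ≡ 1
  G≡1 = coprime∧∣^⇒≡1 m (∤⇒coprime prime[2] (geometricSum-odd n 2∤1+q 2∤n))
                        (subst (G ∣_) qG≡2^m (n∣m*n q))
  odd∧≤1⇒≡1 : ∀ n → 2 ∤ n → n ≤ 1 → n ≡ 1
  odd∧≤1⇒≡1 zero          2∤0 _ = contradiction (2 ∣0) 2∤0
  odd∧≤1⇒≡1 (suc zero)    _   _ = refl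
  odd∧≤1⇒≡1 (suc (suc _)) _   (s≤s ())

8^n%7≡1 : ∀ n → 8 ^ n % 7 ≡ 1
8^n%7≡1 zero    = refl
8^n%7≡1 (suc n) = trans (%-distribˡ-* 8 (8 ^ n) 7) (cong (λ r → (1 * r) % 7) (8^n%7≡1 n))

1+2^[1+3n]%7≡3 : ∀ n → (1 + 2 ^ suc (3 * n)) % 7 ≡ 3
1+2^[1+3n]%7≡3 n = begin
  (1 + 2 * 2 ^ (3 * n)) % 7           ≡⟨ cong (λ t → (1 + 2 * t) % 7) (sym (^-*-assoc 2 3 n)) ⟩
  (1 + 2 * 8 ^ n) % 7                 ≡⟨ %-distribˡ-+ 1 (2 * 8 ^ n) 7 ⟩
  (1 + (2 * 8 ^ n) % 7) % 7           ≡⟨ cong (λ t → (1 + t) % 7) (%-distribˡ-* 2 (8 ^ n) 7) ⟩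
  (1 + (2 * (8 ^ n % 7)) % 7) % 7     ≡⟨ cong (λ r → (1 + (2 * r) % 7) % 7) (8^n%7≡1 n) ⟩
  3                                   ∎
  where open ≡-Reasoning

square%7≢3 : ∀ u → u * u % 7 ≢ 3
square%7≢3 u eq = residue (u % 7) (m%n<n u 7) (trans (sym (%-distribˡ-* u u 7)) eq)
  where
  residue : ∀ r → r < 7 → r * r % 7 ≢ 3
  residue 0 _ ()
  residue 1 _ ()
  residue 2 _ ()
  residue 3 _ ()
  residue 4 _ ()
  residue 5 _ ()
  residue 6 _ ()
  residue (suc (suc (suc (suc (suc (suc (suc _))))))) (s≤s (s≤s (s≤s (s≤s (s≤s (s≤s (s≤s ()))))))) _

square≢1+2^[1+3n] : ∀ u n → u * u ≢ 1 + 2 ^ suc (3 * n)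
square≢1+2^[1+3n] u n eq = square%7≢3 u (trans (cong (_% 7) eq) (1+2^[1+3n]%7≡3 n))

odd^y≡1+2^[1+3n]⇒y≡1 : ∀ {p} y n → 2 ∤ p → p ^ y ≡ 1 + 2 ^ suc (3 * n) → y ≡ 1
odd^y≡1+2^[1+3n]⇒y≡1 {zero} _ _ 2∤0 _ = contradiction (2 ∣0) 2∤0
odd^y≡1+2^[1+3n]⇒y≡1 {p@(suc q)} y n 2∤p eq with 2 ∣? y
... | yes (divides t refl) =
  contradiction (trans (sym p^[t*2]≡p^t*p^t) eq) (square≢1+2^[1+3n] (p ^ t) n)
  where
  p^[t*2]≡p^t*p^t : p ^ (t * 2) ≡ p ^ t * p ^ t
  p^[t*2]≡p^t*p^t = trans (sym (^-*-assoc p t 2)) (cong (p ^ t *_) (*-identityʳ (p ^ t)))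
... | no 2∤y = [1+q]^n≡1+2^m⇒n≡1 q (suc (3 * n)) y 2∤p 2∤y eq

a*[a+2^[1+m]]≡p^n⇒a≡1 : ∀ {p a} m n → Prime p → 2 ∤ p → a * (a + 2 ^ suc m) ≡ p ^ n → a ≡ 1
a*[a+2^[1+m]]≡p^n⇒a≡1 {p} {a} m n pp 2∤p eq with prime-power-factors n pp eq
... | inj₁ a≡1 = a≡1
... | inj₂ (inj₁ b≡1) = contradiction b≡1 (>⇒≢ 1<b)
  where
  1<b : 1 < a + 2 ^ suc m
  1<b = ≤-trans (^-monoʳ-≤ 2 {1} {suc m} (s≤s z≤n)) (m≤n+m (2 ^ suc m) a)
... | inj₂ (inj₂ (p∣a , p∣b)) = contradiction p≡1 (nonTrivial⇒≢1 {{prime⇒nonTrivial pp}})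
  where
  p≡1 : p ≡ 1
  p≡1 = coprime∧∣^⇒≡1 (suc m) (∤⇒coprime prime[2] 2∤p) (∣m+n∣m⇒∣n p∣b p∣a)

64^n≡2^[3n]*2^[3n] : ∀ n → 64 ^ n ≡ 2 ^ (3 * n) * 2 ^ (3 * n)
64^n≡2^[3n]*2^[3n] n = begin
  64 ^ n                    ≡⟨ ^-*-assoc 2 6 n ⟩
  2 ^ (6 * n)               ≡⟨ cong (2 ^_) (*-distribʳ-+ n 3 3) ⟩
  2 ^ (3 * n + 3 * n)       ≡⟨ ^-distribˡ-+-* 2 (3 * n) (3 * n) ⟩
  2 ^ (3 * n) * 2 ^ (3 * n) ∎
  where open ≡-Reasoning

z^2≡z*z : ∀ z → z ^ 2 ≡ z * z
z^2≡z*z z = cong (z *_) (*-identityʳ z)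

2^[3n+1]≡2*2^[3n] : ∀ n → 2 ^ (3 * n + 1) ≡ 2 * 2 ^ (3 * n)
2^[3n+1]≡2*2^[3n] n = cong (2 ^_) (+-comm (3 * n) 1)

w*w+p^y≡z*z⇒z≡w+1 : ∀ {p} x y z → Prime p → 2 ∤ p →
                     2 ^ (3 * x) * 2 ^ (3 * x) + p ^ y ≡ z * z →
                     z ≡ 2 ^ (3 * x) + 1 × p ^ y ≡ 1 + 2 ^ suc (3 * x)
w*w+p^y≡z*z⇒z≡w+1 x y z pp 2∤p eq with m*m+n≡o*o⇒difference-of-squares eq
... | a , z≡w+a , a[a+2w]≡p^y with a*[a+2^[1+m]]≡p^n⇒a≡1 {a = a} (3 * x) y pp 2∤p a[a+2w]≡p^y
... | refl = z≡w+a , trans (sym a[a+2w]≡p^y) (+-identityʳ _)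

64^x+p^y≡z^2⇒solution : ∀ {p} x y z → Prime p → 2 ∤ p → 64 ^ x + p ^ y ≡ z ^ 2 →
                         y ≡ 1 × z ≡ 2 ^ (3 * x) + 1 × p ≡ 1 + 2 ^ (3 * x + 1)
64^x+p^y≡z^2⇒solution {p} x y z pp 2∤p eq
  with w*w+p^y≡z*z⇒z≡w+1 x y z pp 2∤p
         (subst₂ (λ s t → s + p ^ y ≡ t) (64^n≡2^[3n]*2^[3n] x) (z^2≡z*z z) eq)
... | z≡w+1 , p^y≡1+2w with odd^y≡1+2^[1+3n]⇒y≡1 y x 2∤p p^y≡1+2w
... | refl = refl , z≡w+1 ,
  trans (sym (*-identityʳ p)) (trans p^y≡1+2w (cong suc (sym (2^[3n+1]≡2*2^[3n] x))))

2^[3k]+1-solves : ∀ k → 64 ^ k + (1 + 2 ^ (3 * k + 1)) ^ 1 ≡ (2 ^ (3 * k) + 1) ^ 2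
2^[3k]+1-solves k
  rewrite 64^n≡2^[3n]*2^[3n] k | 2^[3n+1]≡2*2^[3n] k = square-identity (2 ^ (3 * k))
  where
  square-identity : ∀ w → w * w + (1 + 2 * w) * 1 ≡ (w + 1) * ((w + 1) * 1)
  square-identity = solve-∀

theorem3 : (p : ℕ) → Prime p → 2 ∤ p → (x y z : ℕ) →
    (64 ^ x + p ^ y ≡ z ^ 2) ⇔
    (∃[ k ] (x ≡ k × y ≡ 1 × z ≡ 2 ^ (3 * k) + 1 × p ≡ 1 + 2 ^ (3 * k + 1)))
theorem3 p pp 2∤p x y z = mk⇔
  (λ eq → x , refl , 64^x+p^y≡z^2⇒solution x y z pp 2∤p eq)
  (λ { (k , refl , refl , refl , refl) → 2^[3k]+1-solves k })
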